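{- Let $x^{\min}=x_0,x_1,\dots,x_N=x^{\max}$ be a full route. Then $N\le b^{\max}|E|/2$, where $b^{\max}=\max_{e\in E}b(e)$.
   Context: Model. $G=(V,E)$ is a finite bipartite graph without multiple edges with color classes $W$ and $F$; an edge joining $w\in W$, $f\in F$ is written $wf$. Capacities $b\in\mathbb Z_+^E$. For $v\in V$, $E_v$ is the set of edges at $v$, $\mathcal B_v=\{z\in\mathbb Z_+^{E_v}:z\le b|_{E_v}\}$, $\mathcal B=\{x\in\mathbb Z_+^E:x\le b\}$, $x_v$ the restriction of $x$ to $E_v$. Vector inequalities componentwise, $\wedge,\vee$ componentwise min/max, $|z|=\sum_e|z(e)|$, $\mathbf 1^e$ unit vector of $e$. Each $v$ has a choice function $C_v:\mathcal B_v\to\mathcal B_v$, $C_v(z)\le z$, with: (A1) $z\ge z'\ge C_v(z)\Rightarrow C_v(z')=C_v(z)$; (A2) $z\ge z'\Rightarrow C_v(z)\wedge z'\le C_v(z')$; (A3) $z\ge z'\Rightarrow|C_v(z)|\ge|C_v(z')|$. $z$ is acceptable if $C_v(z)=z$; for distinct acceptable $z,z'$, $z'\prec_v z$ iff $C_v(z\vee z')=z$. $e\in E_v$ is interesting for $v$ under acceptable $z$ if some $z'\in\mathcal B_v$ agrees with $z$ off $e$, has $z'(e)>z(e)$ and $C_v(z')(e)>z(e)$. A g-matching is $x\in\mathcal B$ with all $x_v$ acceptable; $wf$ blocks $x$ if interesting for $w$ under $x_w$ and for $f$ under $x_f$; stable = no blocking edge; $\mathcal S$ = stable g-matchings; $x\prec_F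 y$ (distinct) iff $x_f\preceq_f y_f$ for all $f\in F$. $(\mathcal S,\prec_F)$ is a finite distributive lattice with least element $x^{\min}$, greatest $x^{\max}$. Rotations. For $x\in\mathcal S$: $U_F^+(x)$ = edges $wf$ interesting for $f$ under $x_f$; $U_F^-(x)$ = edges $wf$ with $x(wf)>0$ not interesting for $f$ under $x_f$. Legal $F$-pair at $f$: distinct $a,c\in E_f$, $a\in U_F^+(x)$, $C_f(x_f+\mathbf 1^a)=x_f+\mathbf 1^a-\mathbf 1^c$. Legal $W$-pair at $w$: $c,a\in E_w$, $c\in U_F^-(x)$, $a\in U_F^+(x)$, $x_w+\mathbf 1^a-\mathbf 1^c$ acceptable; essential if no $d\in(U_F^+(x)\cap E_w)\setminus\{a\}$ is interesting for $w$ under $x_w+\mathbf 1^a-\mathbf 1^c$. A rotation applicable to $x$ is a cyclic sequence $(a_1,c_1,\dots,a_k,c_k)$ of pairwise distinct edges with $(a_i,c_i)$ legal $F$-pairs and $(c_i,a_{i+1})$ essential $W$-pairs (indices mod $k$); $\chi^R$ is $1$ on the $a_i$, $-1$ on the $c_i$, $0$ elsewhere; $\mathcal R(x)$ is the set of them. For $R\in\mathcal R(x)$, $\lambda\ge1$ is feasible if $x+i\chi^R\in\mathcal S$ for $0\le i\le\lambda$ and $R\in\mathcal R(x+i\chi^R)$ for $0\le i<\lambda$; $\tau_R(x)$ is the maximal feasible weight. A full route is a sequence $x^{\min}=x_0,\dots,x_N=x^{\max}$ with $x_i=x_{i-1}+\tau_{R_i}(x_{i-1})\chi^{R_i}$ and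 $R_i\in\mathcal R(x_{i-1})$. -}

module Defs where

open import Data.Nat using (ℕ; zero; suc; _+_; _*_; _∸_; _≤_; _<_; _⊔_; _⊓_)
open import Data.Nat.DivMod using (_mod_)
open import Data.Fin using (Fin; zero; suc; toℕ; inject₁; fromℕ)
import Data.Fin as Fin
open import Data.Sum using (_⊎_; inj₁; inj₂)
open import Data.Product using (Σ; ∃; _×_; _,_)
open import Data.Bool using (if_then_else_)
open import Data.Integer as ℤ using (ℤ; +_)
open import Relation.Nullary using (¬_)
open import Relation.Nullary.Decidable using (⌊_⌋)
open import Relation.Binary.PropositionalEquality using (_≡_; _≢_)

-- Vectors indexed by the edge set E = Fin m, as functions.

Vect : ℕ → Set
Vect m = Fin m → ℕ

sumF : ∀ {m} → Vect m → ℕ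
sumF {zero}  z = 0
sumF {suc m} z = z zero + sumF (λ i → z (suc i))

maxF : ∀ {m} → Vect m → ℕ
maxF {zero}  z = 0
maxF {suc m} z = z zero ⊔ maxF (λ i → z (suc i))

sumℤ : ∀ {k} → (Fin k → ℤ) → ℤ
sumℤ {zero}  z = + 0
sumℤ {suc k} z = z zero ℤ.+ sumℤ (λ i → z (suc i))

module _ {m : ℕ} where
  _≐_ : Vect m → Vect m → Set
  x ≐ y = ∀ e → x e ≡ y e

  _≤ᵥ_ : Vect m → Vect m → Set
  x ≤ᵥ y = ∀ e → x e ≤ y e

  _∧ᵥ_ : Vect m → Vect m → Vect m
  (x ∧ᵥ y) e = x e ⊓ y e

  _∨ᵥ_ : Vect m → Vect m → Vect m
  (x ∨ᵥ y) e = x e ⊔ y e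

  _+ᵥ_ : Vect m → Vect m → Vect m
  (x +ᵥ y) e = x e + y e

  𝟙 : Fin m → Vect m
  𝟙 a e = if ⌊ a Fin.≟ e ⌋ then 1 else 0

  -- z + 1^a - 1^c  (truncated subtraction; it is only used when z(c) > 0
  -- or c = a, where it agrees with integer subtraction)
  upd : Vect m → Fin m → Fin m → Vect m
  upd z a c e = (z e + 𝟙 a e) ∸ 𝟙 c e

-- A finite bipartite graph without multiple edges, with capacities.
-- Edges are Fin m; edge e joins wE e ∈ W = Fin nW and fE e ∈ F = Fin nF.

record Graph : Set where
  field
    m nW nF : ℕ
    wE     : Fin m → Fin nW
    fE     : Fin m → Fin nF
    simple : ∀ e e' → wE e ≡ wE e' → fE e ≡ fE e' → e ≡ e'
    b      : Vect m

module _ (G : Graph) where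
  open Graph G

  Vtx : Set
  Vtx = Fin nW ⊎ Fin nF

  Inc : Vtx → Fin m → Set
  Inc (inj₁ w) e = wE e ≡ w
  Inc (inj₂ f) e = fE e ≡ f

  -- restriction x_v (represented as a vector on E, zero off E_v)
  restr : Vtx → Vect m → Vect m
  restr (inj₁ w) x e = if ⌊ wE e Fin.≟ w ⌋ then x e else 0
  restr (inj₂ f) x e = if ⌊ fE e Fin.≟ f ⌋ then x e else 0

  -- z ∈ 𝓑_v  (vectors on E_v, represented as vectors on E vanishing off E_v)
  InB : Vtx → Vect m → Set
  InB v z = z ≤ᵥ b × (∀ e → ¬ Inc v e → z e ≡ 0)

  record Choice : Set where
    field
      C      : Vtx → Vect m → Vect m
      -- C_v is a function of the vector (extensionality of vectors)
      C-cong : ∀ v z z' → z ≐ z' → C v z ≐ C v z'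
      C-le   : ∀ v z → InB v z → C v z ≤ᵥ z
      A1     : ∀ v z z' → InB v z → InB v z' →
               z' ≤ᵥ z → C v z ≤ᵥ z' → C v z' ≐ C v z
      A2     : ∀ v z z' → InB v z → InB v z' →
               z' ≤ᵥ z → (C v z ∧ᵥ z') ≤ᵥ C v z'
      A3     : ∀ v z z' → InB v z → InB v z' →
               z' ≤ᵥ z → sumF (C v z') ≤ sumF (C v z)

module _ (G : Graph) (CS : Choice G) where
  open Graph G
  open Choice CS

  Acceptable : Vtx G → Vect m → Set
  Acceptable v z = InB G v z × C v z ≐ z

  Prec : Vtx G → Vect m → Vect m → Set
  Prec v z' z = Acceptable v z × Acceptable v z' × ¬ (z ≐ z') × C v (z ∨ᵥ z') ≐ z

  PrecEq : Vtx G → Vect m → Vect m → Set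
  PrecEq v z' z = Prec v z' z ⊎ z' ≐ z

  Interesting : Vtx G → Vect m → Fin m → Set
  Interesting v z e =
    Inc G v e × ∃ λ z' → InB G v z' × (∀ e' → e' ≢ e → z' e' ≡ z e') ×
                         z e < z' e × z e < C v z' e

  GMatching : Vect m → Set
  GMatching x = x ≤ᵥ b × (∀ v → Acceptable v (restr G v x))

  Blocks : Vect m → Fin m → Set
  Blocks x e = Interesting (inj₁ (wE e)) (restr G (inj₁ (wE e)) x) e
             × Interesting (inj₂ (fE e)) (restr G (inj₂ (fE e)) x) e

  Stable : Vect m → Set
  Stable x = GMatching x × (∀ e → ¬ Blocks x e)

  PrecF : Vect m → Vect m → Set
  PrecF x y = ¬ (x ≐ y) × (∀ f → PrecEq (inj₂ f) (restr G (inj₂ f) x) (restr G (inj₂ f) y))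

  IsLeastStable : Vect m → Set
  IsLeastStable x = Stable x × (∀ y → Stable y → ¬ (x ≐ y) → PrecF x y)

  IsGreatestStable : Vect m → Set
  IsGreatestStable x = Stable x × (∀ y → Stable y → ¬ (x ≐ y) → PrecF y x)

  UFplus : Vect m → Fin m → Set
  UFplus x e = Interesting (inj₂ (fE e)) (restr G (inj₂ (fE e)) x) e

  UFminus : Vect m → Fin m → Set
  UFminus x e = 0 < x e × ¬ UFplus x e

  -- legal F-pair (a,c) at f = fE a:
  -- C_f(x_f + 1^a) = x_f + 1^a - 1^c, written as C_f(x_f + 1^a) + 1^c = x_f + 1^a
  LegalFPair : Vect m → Fin m → Fin m → Set
  LegalFPair x a c =
    fE c ≡ fE a × a ≢ c × UFplus x a ×
    ((C (inj₂ (fE a)) (restr G (inj₂ (fE a)) x +ᵥ 𝟙 a) +ᵥ 𝟙 c)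
       ≐ (restr G (inj₂ (fE a)) x +ᵥ 𝟙 a))

  LegalWPair : Vect m → Fin m → Fin m → Set
  LegalWPair x c a =
    wE a ≡ wE c × UFminus x c × UFplus x a ×
    Acceptable (inj₁ (wE c)) (upd (restr G (inj₁ (wE c)) x) a c)

  EssentialWPair : Vect m → Fin m → Fin m → Set
  EssentialWPair x c a =
    LegalWPair x c a ×
    (∀ d → Inc G (inj₁ (wE c)) d → UFplus x d → d ≢ a →
       ¬ Interesting (inj₁ (wE c)) (upd (restr G (inj₁ (wE c)) x) a c) d)

  -- a cyclic sequence (a_1,c_1,...,a_k,c_k), k = suc k₀ ≥ 1
  record Rotation : Set where
    field
      k₀ : ℕ
      a c : Fin (suc k₀) → Fin m

  module _ (R : Rotation) where
    open Rotation R

    nxt : Fin (suc k₀) → Fin (suc k₀)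
    nxt i = suc (toℕ i) mod suc k₀

    PairwiseDistinct : Set
    PairwiseDistinct = (∀ i j → a i ≡ a j → i ≡ j) × (∀ i j → c i ≡ c j → i ≡ j)
                     × (∀ i j → a i ≢ c j)

    Applicable : Vect m → Set
    Applicable x = PairwiseDistinct × (∀ i → LegalFPair x (a i) (c i))
                 × (∀ i → EssentialWPair x (c i) (a (nxt i)))

    χ : Fin m → ℤ
    χ e = sumℤ (λ j → (+ (𝟙 (a j) e)) ℤ.- (+ (𝟙 (c j) e)))

    Shift : Vect m → ℕ → Vect m → Set
    Shift x i y = ∀ e → + (y e) ≡ + (x e) ℤ.+ (+ i) ℤ.* χ e

    Feasible : Vect m → ℕ → Set
    Feasible x l =
      1 ≤ l ×
      (∀ i → i ≤ l → ∃ λ y → Shift x i y × Stable y) ×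
      (∀ i → i < l → ∀ y → Shift x i y → Applicable y)

    IsTau : Vect m → ℕ → Set
    IsTau x t = Feasible x t × (∀ l → Feasible x l → l ≤ t)

  record FullRoute : Set where
    field
      N   : ℕ
      xs  : Fin (suc N) → Vect m
      Rs  : Fin N → Rotation
      ts  : Fin N → ℕ
      start : IsLeastStable (xs zero)
      end   : IsGreatestStable (xs (fromℕ N))
      applicable : ∀ i → Applicable (Rs i) (xs (inject₁ i))
      tau   : ∀ i → IsTau (Rs i) (xs (inject₁ i)) (ts i)
      step  : ∀ i → Shift (Rs i) (xs (inject₁ i)) (ts i) (xs (suc i))

-- Give every edge e the weight y(e) if e is raisable for its firm f under y, i.e.
-- y(e) < b(e) and y(e) < C_f(y_f + 1^e)(e) (equivalently, e is interesting for f), and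
-- 2b(e) - y(e) otherwise; the potential, the sum of the weights, lies in [0, 2|b|].
-- A unit step along a rotation raises every a_i, which is raisable, lowers every c_i,
-- which is not, and by (A1)-(A3) makes no non-raisable edge raisable.  So no weight
-- decreases and each of the 2k edges of the rotation gains at least 1, where k ≥ 2
-- because G is simple.  A step of a full route is τ ≥ 1 such unit steps through
-- g-matchings, so the potential grows by 4 per step and 4N ≤ 2|b| ≤ 2 b^max |E|.

module Submission where

open import Defs
open import Data.Nat
  using (ℕ; zero; suc; _+_; _*_; _∸_; _≤_; _<_; _⊔_; _⊓_; z≤n; s≤s; _≤?_; _<?_)
open import Data.Nat.Properties
open import Data.Nat.Tactic.RingSolver using (solve-∀)
open import Data.Fin using (Fin; zero; suc; inject₁; fromℕ; splitAt; join)
import Data.Fin as Fin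
import Data.Fin.Properties as Finₚ
open import Data.Sum using (_⊎_; inj₁; inj₂; [_,_]′)
open import Data.Product using (_×_; _,_; proj₁; proj₂)
open import Data.Integer as ℤ using (+_)
import Data.Integer.Properties as ℤₚ
import Data.Integer.Tactic.RingSolver as ℤSolver
open import Function using (_∘_)
open import Function.Definitions using (Injective)
open import Relation.Nullary using (¬_; Dec; yes; no; contradiction)
open import Relation.Nullary.Decidable using (_×-dec_)
open import Relation.Binary.PropositionalEquality

module _ {m : ℕ} where

  𝟙-same : (a : Fin m) → 𝟙 a a ≡ 1
  𝟙-same a with a Fin.≟ a
  ... | yes _ = refl
  ... | no a≢a = contradiction refl a≢a

  𝟙-other : {a d : Fin m} → a ≢ d → 𝟙 a d ≡ 0
  𝟙-other {a} {d} a≢d with a Fin.≟ d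
  ... | yes a≡d = contradiction a≡d a≢d
  ... | no _ = refl

  +𝟙-same : (u : Vect m) (a : Fin m) → (u +ᵥ 𝟙 a) a ≡ suc (u a)
  +𝟙-same u a rewrite 𝟙-same a = +-comm (u a) 1

  +𝟙-other : (u : Vect m) {a d : Fin m} → a ≢ d → (u +ᵥ 𝟙 a) d ≡ u d
  +𝟙-other u {d = d} a≢d rewrite 𝟙-other a≢d = +-identityʳ (u d)

  ≤ᵥ-+𝟙 : (u : Vect m) (a : Fin m) → u ≤ᵥ (u +ᵥ 𝟙 a)
  ≤ᵥ-+𝟙 u a d = m≤m+n (u d) (𝟙 a d)

  +𝟙-≤ᵥ : {u v : Vect m} {a : Fin m} → u ≤ᵥ v → u a < v a → (u +ᵥ 𝟙 a) ≤ᵥ v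
  +𝟙-≤ᵥ {u} {v} {a} u≤v ua<va d = by-cases (a Fin.≟ d)
    where
    by-cases : Dec (a ≡ d) → (u +ᵥ 𝟙 a) d ≤ v d
    by-cases (yes refl) = ≤-trans (≤-reflexive (+𝟙-same u a)) ua<va
    by-cases (no a≢d) = ≤-trans (≤-reflexive (+𝟙-other u a≢d)) (u≤v d)

sumF-mono : ∀ {m} {u v : Vect m} → u ≤ᵥ v → sumF u ≤ sumF v
sumF-mono {zero} u≤v = z≤n
sumF-mono {suc m} u≤v = +-mono-≤ (u≤v zero) (sumF-mono (u≤v ∘ suc))

sumF-cong : ∀ {m} {u v : Vect m} → u ≐ v → sumF u ≡ sumF v
sumF-cong {zero} u≐v = refl
sumF-cong {suc m} u≐v = cong₂ _+_ (u≐v zero) (sumF-cong (u≐v ∘ suc))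

sumF-+ : ∀ {m} (u v : Vect m) → sumF (u +ᵥ v) ≡ sumF u + sumF v
sumF-+ {zero} u v = refl
sumF-+ {suc m} u v rewrite sumF-+ (u ∘ suc) (v ∘ suc) = shuffle (u zero) (v zero) _ _
  where
  shuffle : ∀ a b c d → a + b + (c + d) ≡ a + c + (b + d)
  shuffle = solve-∀

sumF-* : ∀ {m} (k : ℕ) (u : Vect m) → sumF (λ e → k * u e) ≡ k * sumF u
sumF-* {zero} k u = sym (*-zeroʳ k)
sumF-* {suc m} k u =
  trans (cong (_+_ (k * u zero)) (sumF-* k (u ∘ suc))) (sym (*-distribˡ-+ k (u zero) _))

sumF-zero : ∀ {m} {u : Vect m} → (∀ e → u e ≡ 0) → sumF u ≡ 0
sumF-zero {zero} u≡0 = refl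
sumF-zero {suc m} u≡0 = cong₂ _+_ (u≡0 zero) (sumF-zero (u≡0 ∘ suc))

sumF-single : ∀ {m} {u : Vect m} (j : Fin m) → (∀ i → i ≢ j → u i ≡ 0) → sumF u ≡ u j
sumF-single {suc m} {u} zero u-off =
  trans (cong (_+_ (u zero)) (sumF-zero (λ i → u-off (suc i) λ ()))) (+-identityʳ (u zero))
sumF-single {suc m} {u} (suc j) u-off =
  cong₂ _+_ (u-off zero λ ())
            (sumF-single j (λ i i≢j → u-off (suc i) (i≢j ∘ Finₚ.suc-injective)))

sumF-+𝟙 : ∀ {m} (u : Vect m) (a : Fin m) → sumF (u +ᵥ 𝟙 a) ≡ suc (sumF u)
sumF-+𝟙 u a = begin
  sumF (u +ᵥ 𝟙 a)       ≡⟨ sumF-+ u (𝟙 a) ⟩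
  sumF u + sumF (𝟙 a)   ≡⟨ cong (_+_ (sumF u)) (trans (sumF-single a 𝟙a-off) (𝟙-same a)) ⟩
  sumF u + 1            ≡⟨ +-comm (sumF u) 1 ⟩
  suc (sumF u)          ∎
  where
  open ≡-Reasoning
  𝟙a-off : ∀ i → i ≢ a → 𝟙 a i ≡ 0
  𝟙a-off i i≢a = 𝟙-other (i≢a ∘ sym)

sumF≤maxF*m : ∀ {m} (u : Vect m) → sumF u ≤ maxF u * m
sumF≤maxF*m {zero} u = z≤n
sumF≤maxF*m {suc m} u = begin
  u zero + sumF (u ∘ suc)          ≤⟨ +-mono-≤ (m≤m⊔n (u zero) M) (sumF≤maxF*m (u ∘ suc)) ⟩
  (u zero ⊔ M) + M * m             ≤⟨ +-monoʳ-≤ (u zero ⊔ M) (*-monoˡ-≤ m (m≤n⊔m (u zero) M)) ⟩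
  (u zero ⊔ M) + (u zero ⊔ M) * m  ≡⟨ *-suc (u zero ⊔ M) m ⟨
  (u zero ⊔ M) * suc m             ∎
  where
  open ≤-Reasoning
  M = maxF (u ∘ suc)

≤ᵥ-sumF-antisym : ∀ {m} {u v : Vect m} → u ≤ᵥ v → sumF v ≤ sumF u → u ≐ v
≤ᵥ-sumF-antisym {suc m} {u} {v} u≤v Σv≤Σu zero =
  ≤-antisym (u≤v zero)
            (+-cancelʳ-≤ _ _ _ (≤-trans Σv≤Σu (+-monoʳ-≤ (u zero) (sumF-mono (u≤v ∘ suc)))))
≤ᵥ-sumF-antisym {suc m} {u} {v} u≤v Σv≤Σu (suc e) =
  ≤ᵥ-sumF-antisym (u≤v ∘ suc)
                  (+-cancelˡ-≤ (v zero) _ _ (≤-trans Σv≤Σu (+-monoˡ-≤ _ (u≤v zero)))) e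

sumF-gain : ∀ {m k} {u v : Vect m} → u ≤ᵥ v → (p : Fin k → Fin m) → Injective _≡_ _≡_ p →
            (∀ i → u (p i) < v (p i)) → sumF u + k ≤ sumF v
sumF-gain {k = zero} {u} u≤v p p-inj u<v =
  ≤-trans (≤-reflexive (+-identityʳ (sumF u))) (sumF-mono u≤v)
sumF-gain {k = suc k} {u} {v} u≤v p p-inj u<v = begin
  sumF u + suc k                  ≡⟨ +-suc (sumF u) k ⟩
  suc (sumF u) + k                ≡⟨ cong (_+ k) (sumF-+𝟙 u (p zero)) ⟨
  sumF (u +ᵥ 𝟙 (p zero)) + k      ≤⟨ sumF-gain (+𝟙-≤ᵥ u≤v (u<v zero)) (p ∘ suc)
                                                (Finₚ.suc-injective ∘ p-inj) u'<v ⟩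
  sumF v                          ∎
  where
  open ≤-Reasoning
  u'<v : ∀ i → (u +ᵥ 𝟙 (p zero)) (p (suc i)) < v (p (suc i))
  u'<v i = subst (_< v (p (suc i))) (sym (+𝟙-other u (λ eq → Finₚ.0≢1+n (p-inj eq)))) (u<v (suc i))

sumℤ-⊖ : ∀ {k} (u v : Vect k) → sumℤ (λ j → + u j ℤ.- + v j) ≡ + sumF u ℤ.- + sumF v
sumℤ-⊖ {zero} u v = refl
sumℤ-⊖ {suc k} u v = begin
  (+ u zero ℤ.- + v zero) ℤ.+ sumℤ (λ j → + u (suc j) ℤ.- + v (suc j))
    ≡⟨ cong (ℤ._+_ (+ u zero ℤ.- + v zero)) (sumℤ-⊖ (u ∘ suc) (v ∘ suc)) ⟩
  (+ u zero ℤ.- + v zero) ℤ.+ (+ sumF (u ∘ suc) ℤ.- + sumF (v ∘ suc))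
    ≡⟨ regroup (+ u zero) (+ v zero) (+ sumF (u ∘ suc)) (+ sumF (v ∘ suc)) ⟩
  (+ u zero ℤ.+ + sumF (u ∘ suc)) ℤ.- (+ v zero ℤ.+ + sumF (v ∘ suc))
    ≡⟨ cong₂ ℤ._-_ (ℤₚ.pos-+ (u zero) _) (ℤₚ.pos-+ (v zero) _) ⟨
  + sumF u ℤ.- + sumF v ∎
  where
  open ≡-Reasoning
  regroup : ∀ a b c d → (a ℤ.- b) ℤ.+ (c ℤ.- d) ≡ (a ℤ.+ c) ℤ.- (b ℤ.+ d)
  regroup = ℤSolver.solve-∀

[,]′-injective : ∀ {A B C : Set} {f : A → C} {g : B → C} →
                 Injective _≡_ _≡_ f → Injective _≡_ _≡_ g → (∀ x y → f x ≢ g y) →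
                 Injective _≡_ _≡_ [ f , g ]′
[,]′-injective f-inj g-inj f≢g {inj₁ x} {inj₁ y} eq = cong inj₁ (f-inj eq)
[,]′-injective f-inj g-inj f≢g {inj₁ x} {inj₂ y} eq = contradiction eq (f≢g x y)
[,]′-injective f-inj g-inj f≢g {inj₂ x} {inj₁ y} eq = contradiction (sym eq) (f≢g y x)
[,]′-injective f-inj g-inj f≢g {inj₂ x} {inj₂ y} eq = cong inj₂ (g-inj eq)

splitAt-injective : ∀ k {l} → Injective _≡_ _≡_ (splitAt k {l})
splitAt-injective k {l} {i} {j} eq =
  trans (sym (Finₚ.join-splitAt k l i)) (trans (cong (join k l) eq) (Finₚ.join-splitAt k l j))

telescope : ∀ {N} (g : ℕ) (Φ : Fin (suc N) → ℕ) →
            (∀ i → Φ (inject₁ i) + g ≤ Φ (suc i)) → Φ zero + N * g ≤ Φ (fromℕ N)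
telescope {zero} g Φ step = ≤-reflexive (+-identityʳ (Φ zero))
telescope {suc N} g Φ step = begin
  Φ zero + (g + N * g)             ≡⟨ shuffle (Φ zero) g (N * g) ⟩
  Φ zero + N * g + g               ≤⟨ +-monoˡ-≤ g (telescope g (Φ ∘ inject₁) (step ∘ inject₁)) ⟩
  Φ (inject₁ (fromℕ N)) + g        ≤⟨ step (fromℕ N) ⟩
  Φ (suc (fromℕ N))                ∎
  where
  open ≤-Reasoning
  shuffle : ∀ a b c → a + (b + c) ≡ a + c + b
  shuffle = solve-∀

weight : ∀ {A : Set} → Dec A → ℕ → ℕ → ℕ
weight (yes _) n B = n
weight (no _) n B = 2 * B ∸ n

module _ {n B : ℕ} where

  weight-yes : ∀ {A : Set} (d : Dec A) → A → weight d n B ≡ n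
  weight-yes (yes _) _ = refl
  weight-yes (no ¬a) a = contradiction a ¬a

  weight-no : ∀ {A : Set} (d : Dec A) → ¬ A → weight d n B ≡ 2 * B ∸ n
  weight-no (yes a) ¬a = contradiction a ¬a
  weight-no (no _) _ = refl

  weight-≥ : ∀ {A : Set} (d : Dec A) → n ≤ B → n ≤ weight d n B
  weight-≥ (yes _) n≤B = ≤-refl
  weight-≥ (no _) n≤B =
    m+n≤o⇒m≤o∸n n (≤-trans (+-mono-≤ n≤B n≤B) (≤-reflexive (cong (_+_ B) (sym (+-identityʳ B)))))

  weight-≤ : ∀ {A : Set} (d : Dec A) → n ≤ B → weight d n B ≤ 2 * B
  weight-≤ (yes _) n≤B = ≤-trans n≤B (m≤m+n B (B + 0))
  weight-≤ (no _) n≤B = m∸n≤m (2 * B) n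

  weight-stay : ∀ {A A' : Set} (d : Dec A) (d' : Dec A') →
                (¬ A → ¬ A') → n ≤ B → weight d n B ≤ weight d' n B
  weight-stay (yes _) d' _ n≤B = weight-≥ d' n≤B
  weight-stay (no ¬a) d' ¬a⇒¬a' n≤B = ≤-reflexive (sym (weight-no d' (¬a⇒¬a' ¬a)))

  weight-cong : ∀ {A A' : Set} (d : Dec A) (d' : Dec A') →
                (A → A') → (A' → A) → weight d n B ≡ weight d' n B
  weight-cong (yes _) (yes _) _ _ = refl
  weight-cong (yes a) (no ¬a') a⇒a' _ = contradiction (a⇒a' a) ¬a'
  weight-cong (no ¬a) (yes a') _ a'⇒a = contradiction (a'⇒a a') ¬a
  weight-cong (no _) (no _) _ _ = refl

module _ (G : Graph) where
  open Graph G

  restr-inside : ∀ v (y : Vect m) {d} → Inc G v d → restr G v y d ≡ y d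
  restr-inside (inj₁ w) y {d} d∈v with wE d Fin.≟ w
  ... | yes _ = refl
  ... | no d∉v = contradiction d∈v d∉v
  restr-inside (inj₂ f) y {d} d∈v with fE d Fin.≟ f
  ... | yes _ = refl
  ... | no d∉v = contradiction d∈v d∉v

  restr-cong : ∀ v {y y' : Vect m} → y ≐ y' → restr G v y ≐ restr G v y'
  restr-cong (inj₁ w) y≐y' d with wE d Fin.≟ w
  ... | yes _ = y≐y' d
  ... | no _ = refl
  restr-cong (inj₂ f) y≐y' d with fE d Fin.≟ f
  ... | yes _ = y≐y' d
  ... | no _ = refl

  InB-+𝟙 : ∀ {v z a} → InB G v z → Inc G v a → z a < b a → InB G v (z +ᵥ 𝟙 a)
  InB-+𝟙 {v} {z} {a} (z≤b , z-off) a∈v za<b = +𝟙-≤ᵥ z≤b za<b , vanishes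
    where
    vanishes : ∀ d → ¬ Inc G v d → (z +ᵥ 𝟙 a) d ≡ 0
    vanishes d d∉v = trans (+𝟙-other z (λ { refl → d∉v a∈v })) (z-off d d∉v)

  InB-∨ : ∀ {v z z'} → InB G v z → InB G v z' → InB G v (z ∨ᵥ z')
  InB-∨ (z≤b , z-off) (z'≤b , z'-off) =
    (λ d → ⊔-lub (z≤b d) (z'≤b d)) , (λ d d∉v → cong₂ _⊔_ (z-off d d∉v) (z'-off d d∉v))

module _ (G : Graph) (CS : Choice G) where
  open Graph G
  open Choice CS

  C-cap : ∀ {v Z w d t} → InB G v Z → InB G v w → w ≤ᵥ Z →
          w d ≡ suc t → C v w d ≤ t → C v Z d ≤ t
  C-cap {v} {Z} {w} {d} {t} Z∈B w∈B w≤Z wd≡1+t Cwd≤t with C v Z d ≤? t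
  ... | yes CZd≤t = CZd≤t
  ... | no CZd≰t = contradiction 1+t≤t (1+n≰n {t})
    where
    capped : C v Z d ⊓ w d ≡ suc t
    capped = trans (cong (_⊓_ (C v Z d)) wd≡1+t) (m≥n⇒m⊓n≡n (≰⇒> CZd≰t))
    1+t≤t : suc t ≤ t
    1+t≤t = ≤-trans (≤-reflexive (sym capped)) (≤-trans (A2 v Z w Z∈B w∈B w≤Z d) Cwd≤t)

  C-between : ∀ {v Z z u} → InB G v Z → Acceptable G CS v z → InB G v u →
              z ≤ᵥ u → u ≤ᵥ Z → C v Z ≤ᵥ z → C v u ≐ z
  C-between {v} {Z} {z} {u} Z∈B (z∈B , Cz≐z) u∈B z≤u u≤Z CZ≤z d =
    trans (A1 v Z u Z∈B u∈B u≤Z (λ d' → ≤-trans (CZ≤z d') (z≤u d')) d) (CZ≐z d)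
    where
    Σz≤ΣCZ : sumF z ≤ sumF (C v Z)
    Σz≤ΣCZ = subst (_≤ sumF (C v Z)) (sumF-cong Cz≐z)
                   (A3 v Z z Z∈B z∈B (λ d' → ≤-trans (z≤u d') (u≤Z d')))
    CZ≐z : C v Z ≐ z
    CZ≐z = ≤ᵥ-sumF-antisym CZ≤z Σz≤ΣCZ

  Raisable : Vtx G → Vect m → Fin m → Set
  Raisable v z e = z e < b e × z e < C v (z +ᵥ 𝟙 e) e

  raisable? : ∀ v z e → Dec (Raisable v z e)
  raisable? v z e = (z e <? b e) ×-dec (z e <? C v (z +ᵥ 𝟙 e) e)

  interesting⇒raisable : ∀ {v z e} → InB G v z → Interesting G CS v z e → Raisable v z e
  interesting⇒raisable {v} {z} {e} z∈B (e∈v , z' , z'∈B , z'≡z , ze<z'e , ze<Cz'e) =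
    <-≤-trans ze<z'e (proj₁ z'∈B e) ,
    ≤-trans (⊓-glb ze<Cz'e (≤-reflexive (sym (+𝟙-same z e)))) (A2 v z' w z'∈B w∈B w≤z' e)
    where
    w = z +ᵥ 𝟙 e
    w≤z' : w ≤ᵥ z'
    w≤z' = +𝟙-≤ᵥ (λ d → by-cases d (d Fin.≟ e)) ze<z'e
      where
      by-cases : ∀ d → Dec (d ≡ e) → z d ≤ z' d
      by-cases d (yes refl) = <⇒≤ ze<z'e
      by-cases d (no d≢e) = ≤-reflexive (sym (z'≡z d d≢e))
    w∈B : InB G v w
    w∈B = InB-+𝟙 G z∈B e∈v (<-≤-trans ze<z'e (proj₁ z'∈B e))

  raisable⇒interesting : ∀ {v z e} → InB G v z → Inc G v e →
                         Raisable v z e → Interesting G CS v z e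
  raisable⇒interesting {v} {z} {e} z∈B e∈v (ze<b , ze<Cwe) =
    e∈v , z +ᵥ 𝟙 e , InB-+𝟙 G z∈B e∈v ze<b , (λ d d≢e → +𝟙-other z (d≢e ∘ sym)) ,
    ≤-reflexive (sym (+𝟙-same z e)) , ze<Cwe

  legal-drop : ∀ {v z a c} → a ≢ c → (C v (z +ᵥ 𝟙 a) +ᵥ 𝟙 c) ≐ (z +ᵥ 𝟙 a) →
               z c ≡ suc (C v (z +ᵥ 𝟙 a) c)
  legal-drop {v} {z} {a} {c} a≢c legal =
    trans (sym (+𝟙-other z a≢c)) (trans (sym (legal c)) (+𝟙-same (C v (z +ᵥ 𝟙 a)) c))

  raisable-cong : ∀ {v z z' e} → z ≐ z' → Raisable v z e → Raisable v z' e
  raisable-cong {v} {z} {z'} {e} z≐z' (ze<b , ze<Cwe) =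
    subst (_< b e) (z≐z' e) ze<b ,
    subst₂ _<_ (z≐z' e) (C-cong v (z +ᵥ 𝟙 e) (z' +ᵥ 𝟙 e) (λ d → cong (_+ 𝟙 e d) (z≐z' d)) e)
           ze<Cwe

  FRaisable : Vect m → Fin m → Set
  FRaisable y e = Raisable (inj₂ (fE e)) (restr G (inj₂ (fE e)) y) e

  fRaisable? : ∀ y e → Dec (FRaisable y e)
  fRaisable? y e = raisable? (inj₂ (fE e)) (restr G (inj₂ (fE e)) y) e

  fRaisable-cong : ∀ {y y' e} → y ≐ y' → FRaisable y e → FRaisable y' e
  fRaisable-cong {e = e} y≐y' = raisable-cong (restr-cong G (inj₂ (fE e)) y≐y')

  edgeWeight : Vect m → Fin m → ℕ
  edgeWeight y e = weight (fRaisable? y e) (y e) (b e)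

  potential : Vect m → ℕ
  potential y = sumF (edgeWeight y)

  potential-≤ : ∀ {y} → y ≤ᵥ b → potential y ≤ 2 * sumF b
  potential-≤ {y} y≤b =
    ≤-trans (sumF-mono (λ e → weight-≤ (fRaisable? y e) (y≤b e))) (≤-reflexive (sumF-* 2 b))

  potential-cong : ∀ {y y'} → y ≐ y' → potential y ≡ potential y'
  potential-cong {y} {y'} y≐y' = sumF-cong λ e →
    trans (weight-cong (fRaisable? y e) (fRaisable? y' e)
                       (fRaisable-cong y≐y') (fRaisable-cong (sym ∘ y≐y')))
          (cong (λ n → weight (fRaisable? y' e) n (b e)) (y≐y' e))

  module UnitStep (R : Rotation G CS) {y y' : Vect m}
                  (distinct : PairwiseDistinct G CS R) (shift : Shift G CS R y 1 y') where
    open Rotation R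

    a-injective : Injective _≡_ _≡_ a
    a-injective {i} {j} = proj₁ distinct i j

    c-injective : Injective _≡_ _≡_ c
    c-injective {i} {j} = proj₁ (proj₂ distinct) i j

    a≢c : ∀ i j → a i ≢ c j
    a≢c = proj₂ (proj₂ distinct)

    hits : (Fin (suc k₀) → Fin m) → Fin m → ℕ
    hits g d = sumF (λ j → 𝟙 (g j) d)

    hits-one : ∀ {g d} j → Injective _≡_ _≡_ g → g j ≡ d → hits g d ≡ 1
    hits-one {g} j g-inj refl =
      trans (sumF-single j (λ i i≢j → 𝟙-other (i≢j ∘ g-inj))) (𝟙-same (g j))

    hits-none : ∀ {g d} → (∀ j → g j ≢ d) → hits g d ≡ 0
    hits-none g≢d = sumF-zero (λ j → 𝟙-other (g≢d j))

    balance : ∀ d → y' d + hits c d ≡ y d + hits a d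
    balance d = ℤₚ.+-injective (begin
      + (y' d + hits c d)
        ≡⟨ ℤₚ.pos-+ (y' d) (hits c d) ⟩
      + y' d ℤ.+ + hits c d
        ≡⟨ cong (ℤ._+ + hits c d) shift-d ⟩
      (+ y d ℤ.+ + 1 ℤ.* (+ hits a d ℤ.- + hits c d)) ℤ.+ + hits c d
        ≡⟨ cancel (+ y d) (+ hits a d) (+ hits c d) ⟩
      + y d ℤ.+ + hits a d
        ≡⟨ ℤₚ.pos-+ (y d) (hits a d) ⟨
      + (y d + hits a d) ∎)
      where
      open ≡-Reasoning
      shift-d : + y' d ≡ + y d ℤ.+ + 1 ℤ.* (+ hits a d ℤ.- + hits c d)
      shift-d = trans (shift d) (cong (λ χd → + y d ℤ.+ + 1 ℤ.* χd)
                                      (sumℤ-⊖ (λ j → 𝟙 (a j) d) (λ j → 𝟙 (c j) d)))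
      cancel : ∀ p A C → (p ℤ.+ + 1 ℤ.* (A ℤ.- C)) ℤ.+ C ≡ p ℤ.+ A
      cancel = ℤSolver.solve-∀

    data Role (d : Fin m) : Set where
      added     : ∀ j → a j ≡ d → Role d
      removed   : ∀ j → c j ≡ d → Role d
      untouched : (∀ j → a j ≢ d) → (∀ j → c j ≢ d) → Role d

    role : ∀ d → Role d
    role d with Finₚ.any? (λ j → a j Fin.≟ d) | Finₚ.any? (λ j → c j Fin.≟ d)
    ... | yes (j , aj≡d) | _              = added j aj≡d
    ... | no _           | yes (j , cj≡d) = removed j cj≡d
    ... | no ∄a          | no ∄c          =
      untouched (λ j aj≡d → ∄a (j , aj≡d)) (λ j cj≡d → ∄c (j , cj≡d))

    added-step : ∀ j → y' (a j) ≡ suc (y (a j))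
    added-step j with balance (a j)
    ... | eq rewrite hits-none {c} (λ i → a≢c j i ∘ sym) | hits-one j a-injective refl =
      trans (sym (+-identityʳ _)) (trans eq (+-comm (y (a j)) 1))

    removed-step : ∀ j → y (c j) ≡ suc (y' (c j))
    removed-step j with balance (c j)
    ... | eq rewrite hits-none {a} (λ i → a≢c i j) | hits-one j c-injective refl =
      trans (sym (+-identityʳ _)) (trans (sym eq) (+-comm (y' (c j)) 1))

    untouched-step : ∀ {d} → (∀ j → a j ≢ d) → (∀ j → c j ≢ d) → y' d ≡ y d
    untouched-step {d} ∄a ∄c with balance d
    ... | eq rewrite hits-none {a} ∄a | hits-none {c} ∄c =
      trans (sym (+-identityʳ _)) (trans eq (+-identityʳ _))

    module _ (gm : GMatching G CS y) (gm' : GMatching G CS y')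
             (legal : ∀ j → LegalFPair G CS y (a j) (c j))
             (leaving : ∀ j → UFminus G CS y (c j)) where

      added-raisable : ∀ j → FRaisable y (a j)
      added-raisable j =
        interesting⇒raisable (proj₁ (proj₂ gm (inj₂ (fE (a j))))) (proj₁ (proj₂ (proj₂ (legal j))))

      removed-unraisable : ∀ j → ¬ FRaisable y (c j)
      removed-unraisable j r =
        proj₂ (leaving j) (raisable⇒interesting (proj₁ (proj₂ gm (inj₂ (fE (c j))))) refl r)

      module _ {e : Fin m} (¬r : ¬ FRaisable y e) (z'e<b : restr G (inj₂ (fE e)) y' e < b e) where
        private
          V : Vtx G
          V = inj₂ (fE e)
          z z' u Z : Vect m
          z = restr G V y
          z' = restr G V y'
          u = z' +ᵥ 𝟙 e
          Z = z ∨ᵥ u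
          z∈B : InB G V z
          z∈B = proj₁ (proj₂ gm V)
          u∈B : InB G V u
          u∈B = InB-+𝟙 G {V} (proj₁ (proj₂ gm' V)) refl z'e<b
          Z∈B : InB G V Z
          Z∈B = InB-∨ G {V} z∈B u∈B
          z≤Z : z ≤ᵥ Z
          z≤Z d = m≤m⊔n (z d) (u d)
          u≤Z : u ≤ᵥ Z
          u≤Z d = m≤n⊔m (z d) (u d)
          y≡z : ∀ {d} → fE d ≡ fE e → y d ≡ z d
          y≡z fd = sym (restr-inside G V y fd)
          y'≡z' : ∀ {d} → fE d ≡ fE e → y' d ≡ z' d
          y'≡z' fd = sym (restr-inside G V y' fd)

        bounded-by : ∀ {d} → Z d ≤ z' d → C V Z d ≤ z' d
        bounded-by {d} Zd≤z'd = ≤-trans (C-le V Z Z∈B d) Zd≤z'd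

        capped : ∀ {p d} → fE p ≡ fE e → z p < u p → (z +ᵥ 𝟙 p) d ≡ suc (z' d) →
                 C V (z +ᵥ 𝟙 p) d ≤ z' d → C V Z d ≤ z' d
        capped {p} fp zp<up = C-cap Z∈B (InB-+𝟙 G {V} z∈B fp (<-≤-trans zp<up (proj₁ u∈B p)))
                                        (+𝟙-≤ᵥ z≤Z (<-≤-trans zp<up (u≤Z p)))

        added-grows : ∀ {j} → fE (a j) ≡ fE e → z (a j) < z' (a j)
        added-grows {j} fa = subst₂ _<_ (y≡z fa) (y'≡z' fa) (≤-reflexive (sym (added-step j)))

        off-firm-below : ∀ {d} → fE d ≢ fE e → C V Z d ≤ z' d
        off-firm-below {d} d∉V = bounded-by (≤-reflexive (trans (proj₂ Z∈B d d∉V) (sym (z'-off d d∉V))))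
          where
          z'-off = proj₂ (proj₁ (proj₂ gm' V))

        added-below : ∀ j → fE (a j) ≡ fE e → C V Z (a j) ≤ z' (a j)
        added-below j fa = bounded-by (⊔-lub (<⇒≤ (added-grows fa)) (≤-reflexive (+𝟙-other z' e≢aj)))
          where
          e≢aj : e ≢ a j
          e≢aj refl = ¬r (added-raisable j)

        removed-below : ∀ j → fE (c j) ≡ fE e → C V Z (c j) ≤ z' (c j)
        removed-below j fc =
          capped fa (<-≤-trans (added-grows fa) (≤ᵥ-+𝟙 z' e (a j))) wc≡1+z'c (≤-reflexive Cwc≡z'c)
          where
          fa : fE (a j) ≡ fE e
          fa = trans (sym (proj₁ (legal j))) fc
          zc≡1+z'c : z (c j) ≡ suc (z' (c j))
          zc≡1+z'c = trans (sym (y≡z fc)) (trans (removed-step j) (cong suc (y'≡z' fc)))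
          wc≡1+z'c : (z +ᵥ 𝟙 (a j)) (c j) ≡ suc (z' (c j))
          wc≡1+z'c = trans (+𝟙-other z (a≢c j j)) zc≡1+z'c
          legal-at-V : (C V (z +ᵥ 𝟙 (a j)) +ᵥ 𝟙 (c j)) ≐ (z +ᵥ 𝟙 (a j))
          legal-at-V = subst (λ f → (C (inj₂ f) (restr G (inj₂ f) y +ᵥ 𝟙 (a j)) +ᵥ 𝟙 (c j))
                                    ≐ (restr G (inj₂ f) y +ᵥ 𝟙 (a j)))
                             fa (proj₂ (proj₂ (proj₂ (legal j))))
          Cwc≡z'c : C V (z +ᵥ 𝟙 (a j)) (c j) ≡ z' (c j)
          Cwc≡z'c = suc-injective (trans (sym (legal-drop (a≢c j j) legal-at-V)) zc≡1+z'c)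

        untouched-below : ∀ {d} → fE d ≡ fE e → (∀ j → a j ≢ d) → (∀ j → c j ≢ d) →
                          C V Z d ≤ z' d
        untouched-below {d} fd ∄a ∄c with e Fin.≟ d
        ... | no e≢d = bounded-by (⊔-lub (≤-reflexive zd≡z'd) (≤-reflexive (+𝟙-other z' e≢d)))
          where
          zd≡z'd : z d ≡ z' d
          zd≡z'd = trans (sym (y≡z fd)) (trans (sym (untouched-step ∄a ∄c)) (y'≡z' fd))
        ... | yes refl = capped refl (subst (_< u e) (sym ze≡z'e) (≤-reflexive (sym (+𝟙-same z' e))))
                                (trans (+𝟙-same z e) (cong suc ze≡z'e))
                                (subst (C V (z +ᵥ 𝟙 e) e ≤_) ze≡z'e Cwe≤ze)
          where
          ze≡z'e : z e ≡ z' e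
          ze≡z'e = trans (sym (y≡z refl)) (trans (sym (untouched-step ∄a ∄c)) (y'≡z' refl))
          Cwe≤ze : C V (z +ᵥ 𝟙 e) e ≤ z e
          Cwe≤ze = ≮⇒≥ (λ ze<Cwe → ¬r (subst (_< b e) (sym ze≡z'e) z'e<b , ze<Cwe))

        -- By A2: at a removed edge compare Z with the bump of z at the matching added
        -- edge of the legal F-pair, at e with z + 1^e, which e does not gain from.
        choice-below : C V Z ≤ᵥ z'
        choice-below d = by-role (fE d Fin.≟ fE e) (role d)
          where
          by-role : Dec (fE d ≡ fE e) → Role d → C V Z d ≤ z' d
          by-role (no d∉V) _ = off-firm-below d∉V
          by-role (yes fd) (added j refl) = added-below j fd
          by-role (yes fd) (removed j refl) = removed-below j fd
          by-role (yes fd) (untouched ∄a ∄c) = untouched-below fd ∄a ∄c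

        choice-of-u : C V u ≐ z'
        choice-of-u = C-between Z∈B (proj₂ gm' V) u∈B (≤ᵥ-+𝟙 z' e) u≤Z choice-below

      unraisable-stays : ∀ {e} → ¬ FRaisable y e → ¬ FRaisable y' e
      unraisable-stays {e} ¬r (z'e<b , z'e<Cue) = <-irrefl (sym (choice-of-u ¬r z'e<b e)) z'e<Cue

      added-gain : ∀ j → edgeWeight y (a j) < edgeWeight y' (a j)
      added-gain j = begin-strict
        edgeWeight y (a j)   ≡⟨ weight-yes (fRaisable? y (a j)) (added-raisable j) ⟩
        y (a j)              <⟨ ≤-reflexive (sym (added-step j)) ⟩
        y' (a j)             ≤⟨ weight-≥ (fRaisable? y' (a j)) (proj₁ gm' (a j)) ⟩
        edgeWeight y' (a j)  ∎
        where open ≤-Reasoning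

      removed-gain : ∀ j → edgeWeight y (c j) < edgeWeight y' (c j)
      removed-gain j = begin-strict
        edgeWeight y (c j)       ≡⟨ weight-no (fRaisable? y (c j)) (removed-unraisable j) ⟩
        2 * b (c j) ∸ y (c j)    <⟨ ∸-monoʳ-< (≤-reflexive (sym (removed-step j))) yc≤2b ⟩
        2 * b (c j) ∸ y' (c j)   ≡⟨ weight-no (fRaisable? y' (c j)) unraisable ⟨
        edgeWeight y' (c j)      ∎
        where
        open ≤-Reasoning
        unraisable = unraisable-stays (removed-unraisable j)
        yc≤2b : y (c j) ≤ 2 * b (c j)
        yc≤2b = ≤-trans (proj₁ gm (c j)) (m≤m+n (b (c j)) (b (c j) + 0))

      edgeWeight-mono : edgeWeight y ≤ᵥ edgeWeight y'
      edgeWeight-mono d with role d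
      ... | added j refl = <⇒≤ (added-gain j)
      ... | removed j refl = <⇒≤ (removed-gain j)
      ... | untouched ∄a ∄c =
        subst (λ n → edgeWeight y d ≤ weight (fRaisable? y' d) n (b d)) (sym (untouched-step ∄a ∄c))
              (weight-stay (fRaisable? y d) (fRaisable? y' d) unraisable-stays (proj₁ gm d))

      potential-gain : potential y + (suc k₀ + suc k₀) ≤ potential y'
      potential-gain = sumF-gain edgeWeight-mono ([ a , c ]′ ∘ splitAt (suc k₀))
                         (splitAt-injective (suc k₀) ∘ [,]′-injective a-injective c-injective a≢c)
                         (λ i → gain-at (splitAt (suc k₀) i))
        where
        gain-at : ∀ s → edgeWeight y ([ a , c ]′ s) < edgeWeight y' ([ a , c ]′ s)
        gain-at (inj₁ j) = added-gain j
        gain-at (inj₂ j) = removed-gain j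

  -- A rotation of length one would pair a₁ and c₁ both at a firm and at a worker.
  rotation-length≥2 : ∀ {R y} → Applicable G CS R y → 2 ≤ suc (Rotation.k₀ R)
  rotation-length≥2 {record { k₀ = suc k₀ }} _ = s≤s (s≤s z≤n)
  rotation-length≥2 {record { k₀ = zero ; a = a ; c = c }} (_ , legal , essential) =
    contradiction (simple (a zero) (c zero) same-worker (sym (proj₁ (legal zero))))
                  (proj₁ (proj₂ (legal zero)))
    where
    same-worker : wE (a zero) ≡ wE (c zero)
    same-worker = proj₁ (proj₁ (essential zero))

  rotation-gain : ∀ {R y y'} → Applicable G CS R y → GMatching G CS y → GMatching G CS y' →
                  Shift G CS R y 1 y' → potential y + 4 ≤ potential y'
  rotation-gain {R} {y} app@(distinct , legal , essential) gm gm' shift =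
    ≤-trans (+-monoʳ-≤ _ (+-mono-≤ (rotation-length≥2 app) (rotation-length≥2 app)))
            (UnitStep.potential-gain R distinct shift gm gm' legal leaving)
    where
    leaving : ∀ j → UFminus G CS y (Rotation.c R j)
    leaving j = proj₁ (proj₂ (proj₁ (essential j)))

  shift-split : ∀ {R x j yⱼ y} → Shift G CS R x j yⱼ → Shift G CS R x (suc j) y →
                Shift G CS R yⱼ 1 y
  shift-split {R} {x} {j} {yⱼ} {y} shiftⱼ shift e =
    trans (shift e) (trans (regroup (+ x e) (+ j) (χ G CS R e))
                           (cong (λ t → t ℤ.+ + 1 ℤ.* χ G CS R e) (sym (shiftⱼ e))))
    where
    regroup : ∀ X J K → X ℤ.+ (+ 1 ℤ.+ J) ℤ.* K ≡ (X ℤ.+ J ℤ.* K) ℤ.+ + 1 ℤ.* K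
    regroup = ℤSolver.solve-∀

  feasible-gain : ∀ {R x τ} → Feasible G CS R x τ →
                  ∀ j → j ≤ τ → ∀ {y} → Shift G CS R x j y → GMatching G CS y →
                  potential x + j * 4 ≤ potential y
  feasible-gain {x = x} _ zero _ {y} shift _ =
    ≤-reflexive (trans (+-identityʳ (potential x)) (potential-cong x≐y))
    where
    x≐y : x ≐ y
    x≐y e = trans (sym (+-identityʳ (x e))) (sym (ℤₚ.+-injective (shift e)))
  feasible-gain {R} {x} feasible@(_ , stable , applicable) (suc j) 1+j≤τ shift gm
    with stable j (≤-trans (n≤1+n j) 1+j≤τ)
  ... | yⱼ , shiftⱼ , (gmⱼ , _) = begin
    potential x + (4 + j * 4)   ≡⟨ shuffle (potential x) (j * 4) ⟩
    potential x + j * 4 + 4     ≤⟨ +-monoˡ-≤ 4 (feasible-gain feasible j j≤τ shiftⱼ gmⱼ) ⟩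
    potential yⱼ + 4            ≤⟨ rotation-gain {R} (applicable j 1+j≤τ yⱼ shiftⱼ) gmⱼ gm unit-shift ⟩
    potential _                 ∎
    where
    open ≤-Reasoning
    j≤τ = ≤-trans (n≤1+n j) 1+j≤τ
    unit-shift = shift-split {R} {x} {j} shiftⱼ shift
    shuffle : ∀ p q → p + (4 + q) ≡ p + q + 4
    shuffle = solve-∀

  module _ (ρ : FullRoute G CS) where
    open FullRoute ρ

    route-step-gain : ∀ i → potential (xs (inject₁ i)) + 4 ≤ potential (xs (suc i))
    route-step-gain i with proj₁ (proj₂ (proj₁ (tau i))) (ts i) ≤-refl
    ... | y , shift , (gm , _) = begin
      potential (xs (inject₁ i)) + 4         ≤⟨ +-monoʳ-≤ _ (*-monoˡ-≤ 4 (proj₁ (proj₁ (tau i)))) ⟩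
      potential (xs (inject₁ i)) + ts i * 4  ≤⟨ feasible-gain (proj₁ (tau i)) (ts i) ≤-refl shift gm ⟩
      potential y                            ≡⟨ potential-cong y≐xᵢ₊₁ ⟩
      potential (xs (suc i))                 ∎
      where
      open ≤-Reasoning
      y≐xᵢ₊₁ : y ≐ xs (suc i)
      y≐xᵢ₊₁ e = ℤₚ.+-injective (trans (shift e) (sym (step i e)))

lemma6p2 : (G : Graph) (CS : Choice G) (ρ : FullRoute G CS) →
           2 * FullRoute.N ρ ≤ maxF (Graph.b G) * Graph.m G
lemma6p2 G CS ρ = *-cancelˡ-≤ 2 (begin
  2 * (2 * N)                  ≡⟨ four-times N ⟩
  N * 4                        ≤⟨ m≤n+m (N * 4) _ ⟩
  Φ (xs zero) + N * 4          ≤⟨ telescope 4 (Φ ∘ xs) (route-step-gain G CS ρ) ⟩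
  Φ (xs (fromℕ N))             ≤⟨ potential-≤ G CS (proj₁ (proj₁ (proj₁ end))) ⟩
  2 * sumF b                   ≤⟨ *-monoʳ-≤ 2 (sumF≤maxF*m b) ⟩
  2 * (maxF b * m)             ∎)
  where
  open Graph G
  open FullRoute ρ
  open ≤-Reasoning
  Φ = potential G CS
  four-times : ∀ n → 2 * (2 * n) ≡ n * 4
  four-times = solve-∀
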